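{- Let $q$ be a prime power and let $\Delta\neq 0$ be an element of $\mathbb{C}_\infty$. Let $\phi$ be the rank $2$ Drinfeld module with $\phi_T=T-(T+\Delta)\tau+\Delta\tau^2$, let $\log_\phi(z)=\sum_{i\ge0}\beta_i z^{q^i}$ be its logarithm, and set $\mathfrak{a}_n:=T\sum_{i=0}^n\beta_i$ and $D:=\Delta/T^q$. Then for every $n\ge 0$, \[ \mathfrak{a}_n=\frac{T^{1+q+q^2+\cdots+q^n}}{L_n}\sum_{S\subset\{0,1,\dots,n-1\}}\frac{D^{w(S)}}{m(S)}. \]
   Context: $\mathbb{C}_\infty$ is the completion of an algebraic closure of $\mathbb{F}_q((1/T))$. The logarithm $\log_\phi(z)=\sum_i\beta_i z^{q^i}$ is the formal power series with $\beta_0=1$ satisfying $T\log_\phi(z)=\log_\phi(\phi_T(z))$, where $\tau z=z^q\tau$. Notation: $[n]:=T^{q^n}-T$; $L_n:=[n][n-1]\cdots[1]$, $L_0:=1$. For a finite set $S\subset\{0,1,2,\dots\}$: $w(S):=\sum_{i\in S}q^i$; $M(S):=\{i\in S:i-1\notin S\}$; $m(S):=\prod_{i\in M(S)}T^{q^i-1}$ (so $m(\emptyset)=1$). For $n=0$ the set $\{0,\dots,n-1\}$ is empty. -}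

module Defs where

open import Level using (Level; _⊔_)
open import Data.Product using (_×_)
open import Data.Nat as ℕ using (ℕ; zero; suc)
open import Data.Bool using (Bool; true; false; _∧_; not; if_then_else_)
open import Data.Vec using (Vec; []; _∷_)
open import Data.List using (List; []; _∷_; map; _++_; foldr)
open import Relation.Nullary using (¬_)
open import Algebra.Bundles using (CommutativeRing)

record Field (c ℓ : Level) : Set (Level.suc (c ⊔ ℓ)) where
  field
    commutativeRing : CommutativeRing c ℓ
  open CommutativeRing commutativeRing public
  field
    _⁻¹       : Carrier → Carrier
    ⁻¹-inverse : ∀ x → ¬ (x ≈ 0#) → x * (x ⁻¹) ≈ 1#
    0≉1       : ¬ (0# ≈ 1#)

-- All subsets of {0,…,n-1}, encoded as characteristic vectors
-- (entry number i says whether i ∈ S).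
subsets : (n : ℕ) → List (Vec Bool n)
subsets zero    = [] ∷ []
subsets (suc n) = map (true ∷_) (subsets n) ++ map (false ∷_) (subsets n)

-- w(S) = Σ_{i ∈ S} q^i, where the first entry of the vector has index i.
wFrom : (q i : ℕ) {n : ℕ} → Vec Bool n → ℕ
wFrom q i []           = 0
wFrom q i (true ∷ bs)  = q ℕ.^ i ℕ.+ wFrom q (suc i) bs
wFrom q i (false ∷ bs) = wFrom q (suc i) bs

ℕ-sum : ℕ → (ℕ → ℕ) → ℕ
ℕ-sum zero    f = f 0
ℕ-sum (suc n) f = ℕ-sum n f ℕ.+ f (suc n)

w : (q : ℕ) {n : ℕ} → Vec Bool n → ℕ
w q S = wFrom q 0 S

module FieldOps {c ℓ : Level} (F : Field c ℓ) where
  open Field F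

  pow : Carrier → ℕ → Carrier
  pow x zero    = 1#
  pow x (suc n) = x * pow x n

  _/_ : Carrier → Carrier → Carrier
  x / y = x * (y ⁻¹)

  natCast : ℕ → Carrier
  natCast zero    = 0#
  natCast (suc n) = 1# + natCast n

  sumTo : ℕ → (ℕ → Carrier) → Carrier
  sumTo zero    f = f 0
  sumTo (suc n) f = sumTo n f + f (suc n)

  sumList : List Carrier → Carrier
  sumList = foldr _+_ 0#

  bracket : (q : ℕ) (T : Carrier) (n : ℕ) → Carrier
  bracket q T n = pow T (q ℕ.^ n) - T

  L : (q : ℕ) (T : Carrier) (n : ℕ) → Carrier
  L q T zero    = 1#
  L q T (suc n) = bracket q T (suc n) * L q T n

  -- m(S) = Π_{i ∈ M(S)} T^{q^i - 1}, M(S) = {i ∈ S : i-1 ∉ S};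
  -- 'prev' records whether i-1 ∈ S (false for i = 0).
  mFrom : (q : ℕ) (T : Carrier) (i : ℕ) (prev : Bool) {n : ℕ} → Vec Bool n → Carrier
  mFrom q T i prev []       = 1#
  mFrom q T i prev (b ∷ bs) =
    (if b ∧ not prev then pow T (q ℕ.^ i ℕ.∸ 1) else 1#) * mFrom q T (suc i) b bs

  m : (q : ℕ) (T : Carrier) {n : ℕ} → Vec Bool n → Carrier
  m q T S = mFrom q T 0 false S

  -- coefficients of φ_T = T - (T+Δ)τ + Δτ²
  phiT : (T Δ : Carrier) → ℕ → Carrier
  phiT T Δ 0 = T
  phiT T Δ 1 = - (T + Δ)
  phiT T Δ 2 = Δ
  phiT T Δ (suc (suc (suc _))) = 0#

  -- coefficient of τ^k in (Σ β_i τ^i)(Σ φ_j τ^j) in the twisted power series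
  -- ring (τ a = a^q τ):  Σ_{i+j=k} β_i φ_j^{q^i}
  twistedCoeff : (q : ℕ) (β φ : ℕ → Carrier) (k : ℕ) → Carrier
  twistedCoeff q β φ k = sumTo k (λ i → β i * pow (φ (k ℕ.∸ i)) (q ℕ.^ i))

  -- log_φ = Σ β_i τ^i is the logarithm of φ: β_0 = 1 and T·log_φ = log_φ ∘ φ_T
  IsLogarithm : (q : ℕ) (T Δ : Carrier) (β : ℕ → Carrier) → Set ℓ
  IsLogarithm q T Δ β =
    (β 0 ≈ 1#) × (∀ k → T * β k ≈ twistedCoeff q β (phiT T Δ) k)

-- Put 𝔞ₙ = T·Σ_{i≤n} βᵢ and cₙ = T·βₙ. As q is a power of the characteristic, x ↦ x^{q^j} is
-- additive, so the τᵏ-coefficient of T·log_φ = log_φ ∘ φ_T is the three-term recursion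
-- [k]βₖ = (T^{q^{k-1}} + Δ^{q^{k-1}})β_{k-1} − Δ^{q^{k-2}}β_{k-2}, which sums to the first-order system
--   𝔞_{n+1} = 𝔞ₙ + c_{n+1},   [n+1]·c_{n+1} = T·𝔞ₙ + Δ^{qⁿ}·cₙ,   𝔞₀ = c₀ = T.
-- It has only one solution since every [n+1] ≠ 0. Splitting the subsets S ⊆ {0,…,n−1} by whether
-- n−1 ∈ S writes the subset sum as Aₙ + Bₙ, where (A, B) obeys a two-term linear recursion, and with
-- Pₙ = T^{1+q+⋯+qⁿ}/Lₙ the pair (Pₙ(Aₙ + Bₙ), Pₙ(Aₙ + Bₙ·T^{1−qⁿ})) solves the same system.
module Submission where

open import Defs
open import Level using (Level; 0ℓ; _⊔_)
open import Data.Nat as ℕ using (ℕ; zero; suc; _≤_; _<_; _^_; _∸_; s≤s; z≤n; NonZero)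
import Data.Nat.Properties as NP
open import Data.Nat.Divisibility using (_∣_; divides; ∣⇒≤)
open import Data.Nat.Primality using (Prime; euclidsLemma; ¬prime[0]; prime⇒nonZero)
open import Data.Nat.Combinatorics using (_C_; nCn≡1; nC1≡n; nCk+nC[k+1]≡[n+1]C[k+1])
open import Data.Fin as Fin using (toℕ; fromℕ; inject₁)
import Data.Fin.Properties as FinP
open import Data.Bool using (Bool; true; false; _∧_; not; if_then_else_)
open import Data.Vec using (Vec; []; _∷_)
open import Data.List using ([]; _∷_; map; _++_)
open import Data.Maybe using (just; nothing)
open import Data.Product using (_×_; _,_; proj₁; proj₂; swap)
open import Data.Product.Relation.Binary.Pointwise.NonDependent using (×-setoid)
open import Data.Sum using (inj₁; inj₂)
open import Relation.Nullary using (¬_; yes; no; contradiction)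
open import Relation.Binary.Bundles using (Setoid)
open import Relation.Binary.Definitions using (WeaklyDecidable)
open import Relation.Binary.PropositionalEquality as ≡ using (_≡_)
open import Algebra.Bundles using (RawRing; CommutativeRing)
open import Algebra.Solver.Ring.AlmostCommutativeRing
  using (fromCommutativeRing; _-Raw-AlmostCommutative⟶_)

module DifferenceCoefficientRingSolver {c ℓ} (R : CommutativeRing c ℓ) where
  open CommutativeRing R
  open import Algebra.Properties.Ring ring
    using (-‿involutive; -‿anti-homo-+; -‿+-comm; -‿distribˡ-*; -‿distribʳ-*)
  open import Algebra.Properties.Semiring.Mult semiring
    using (×-homo-+; ×1-homo-*) renaming (_×_ to _·_)
  open import Algebra.Solver.CommutativeMonoid +-commutativeMonoid
    using (_⊕_; _⊜_) renaming (solve to +-solve)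
  open import Relation.Binary.Reasoning.Setoid setoid

  private
    -- The integer m - n is coded by (m , n); `reduce` makes one entry zero,
    -- so that equal coefficients are syntactically equal.
    reduce : ℕ × ℕ → ℕ × ℕ
    reduce (m , n) = m ∸ n , n ∸ m

    Differences : RawRing 0ℓ 0ℓ
    Differences = record
      { Carrier = ℕ × ℕ
      ; _≈_     = _≡_
      ; _+_     = λ (a , b) (c , d) → reduce (a ℕ.+ c , b ℕ.+ d)
      ; _*_     = λ (a , b) (c , d) → reduce (a ℕ.* c ℕ.+ b ℕ.* d , a ℕ.* d ℕ.+ b ℕ.* c)
      ; -_      = swap
      ; 0#      = 0 , 0
      ; 1#      = 1 , 0
      }

    difference : ℕ × ℕ → Carrier
    difference (m , n) = m · 1# - n · 1#

    -- 0 and 1 are sent to 0# and 1# on the nose, so that constants written in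
    -- solver equations match the 0# and 1# occurring in goals.
    ⟦_⟧ : ℕ × ℕ → Carrier
    ⟦ 0 , 0 ⟧ = 0#
    ⟦ 1 , 0 ⟧ = 1#
    ⟦ x ⟧     = difference x

    difference[1,0]≈1# : difference (1 , 0) ≈ 1#
    difference[1,0]≈1# = trans (+-assoc _ _ _) (trans (+-congˡ (-‿inverseʳ 0#)) (+-identityʳ 1#))

    ⟦⟧≈difference : ∀ x → ⟦ x ⟧ ≈ difference x
    ⟦⟧≈difference (zero , zero)        = sym (-‿inverseʳ 0#)
    ⟦⟧≈difference (zero , suc n)       = refl
    ⟦⟧≈difference (suc zero , zero)    = sym difference[1,0]≈1#
    ⟦⟧≈difference (suc zero , suc n)   = refl
    ⟦⟧≈difference (suc (suc m) , n)    = refl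

    difference[1+m,1+n] : ∀ m n → difference (suc m , suc n) ≈ difference (m , n)
    difference[1+m,1+n] m n = begin
      (1# + M) + - (1# + N)     ≈⟨ +-congˡ (-‿+-comm 1# N) ⟨
      (1# + M) + (- 1# + - N)   ≈⟨ +-solve 4 (λ a b c d → (a ⊕ b) ⊕ (c ⊕ d) ⊜ (a ⊕ c) ⊕ (b ⊕ d)) refl 1# M (- 1#) (- N) ⟩
      (1# - 1#) + (M - N)       ≈⟨ +-congʳ (-‿inverseʳ 1#) ⟩
      0# + (M - N)              ≈⟨ +-identityˡ _ ⟩
      M - N                     ∎
      where M = m · 1#; N = n · 1#

    difference∘reduce : ∀ x → difference (reduce x) ≈ difference x
    difference∘reduce (zero  , zero ) = refl
    difference∘reduce (zero  , suc n) = refl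
    difference∘reduce (suc m , zero ) = refl
    difference∘reduce (suc m , suc n) = trans (difference∘reduce (m , n)) (sym (difference[1+m,1+n] m n))

    difference-+ : ∀ a b c d → difference (a ℕ.+ c , b ℕ.+ d) ≈ difference (a , b) + difference (c , d)
    difference-+ a b c d = begin
      (a ℕ.+ c) · 1# - (b ℕ.+ d) · 1#  ≈⟨ +-cong (×-homo-+ 1# a c) (-‿cong (×-homo-+ 1# b d)) ⟩
      (a′ + c′) + - (b′ + d′)              ≈⟨ +-congˡ (-‿+-comm b′ d′) ⟨
      (a′ + c′) + (- b′ + - d′)            ≈⟨ +-solve 4 (λ a b c d → (a ⊕ b) ⊕ (c ⊕ d) ⊜ (a ⊕ c) ⊕ (b ⊕ d)) refl a′ c′ (- b′) (- d′) ⟩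
      (a′ - b′) + (c′ - d′)                ∎
      where a′ = a · 1#; b′ = b · 1#; c′ = c · 1#; d′ = d · 1#

    [x-y]*[z-w] : ∀ x y z w → (x - y) * (z - w) ≈ (x * z + y * w) - (x * w + y * z)
    [x-y]*[z-w] x y z w = begin
      (x - y) * (z - w)                             ≈⟨ distribʳ _ _ _ ⟩
      x * (z - w) + - y * (z - w)                   ≈⟨ +-cong (distribˡ _ _ _) (distribˡ _ _ _) ⟩
      (x * z + x * - w) + (- y * z + - y * - w)     ≈⟨ +-cong (+-congˡ (-‿distribʳ-* x w)) (+-cong (-‿distribˡ-* y z) y*w≈-y*-w) ⟨
      (x * z + - (x * w)) + (- (y * z) + y * w)     ≈⟨ +-solve 4 (λ a b c d → (a ⊕ b) ⊕ (c ⊕ d) ⊜ (a ⊕ d) ⊕ (b ⊕ c)) refl (x * z) (- (x * w)) (- (y * z)) (y * w) ⟩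
      (x * z + y * w) + (- (x * w) + - (y * z))     ≈⟨ +-congˡ (-‿+-comm _ _) ⟩
      (x * z + y * w) - (x * w + y * z)             ∎
      where
      y*w≈-y*-w : y * w ≈ - y * - w
      y*w≈-y*-w = begin
        y * w          ≈⟨ -‿involutive _ ⟨
        - - (y * w)    ≈⟨ -‿cong (-‿distribʳ-* y w) ⟩
        - (y * - w)    ≈⟨ -‿distribˡ-* y (- w) ⟩
        - y * - w      ∎

    difference-* : ∀ a b c d → difference (a ℕ.* c ℕ.+ b ℕ.* d , a ℕ.* d ℕ.+ b ℕ.* c) ≈ difference (a , b) * difference (c , d)
    difference-* a b c d = begin
      (a ℕ.* c ℕ.+ b ℕ.* d) · 1# - (a ℕ.* d ℕ.+ b ℕ.* c) · 1#
        ≈⟨ +-cong (×-homo-+ 1# (a ℕ.* c) (b ℕ.* d)) (-‿cong (×-homo-+ 1# (a ℕ.* d) (b ℕ.* c))) ⟩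
      ((a ℕ.* c) · 1# + (b ℕ.* d) · 1#) - ((a ℕ.* d) · 1# + (b ℕ.* c) · 1#)
        ≈⟨ +-cong (+-cong (×1-homo-* a c) (×1-homo-* b d)) (-‿cong (+-cong (×1-homo-* a d) (×1-homo-* b c))) ⟩
      (a′ * c′ + b′ * d′) - (a′ * d′ + b′ * c′)
        ≈⟨ [x-y]*[z-w] a′ b′ c′ d′ ⟨
      (a′ - b′) * (c′ - d′) ∎
      where a′ = a · 1#; b′ = b · 1#; c′ = c · 1#; d′ = d · 1#

    difference-swap : ∀ a b → difference (b , a) ≈ - difference (a , b)
    difference-swap a b = begin
      b′ - a′        ≈⟨ +-congʳ (-‿involutive b′) ⟨
      - - b′ - a′    ≈⟨ -‿anti-homo-+ a′ (- b′) ⟨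
      - (a′ - b′)    ∎
      where a′ = a · 1#; b′ = b · 1#

    difference[n,n]≈0# : ∀ n → difference (n , n) ≈ 0#
    difference[n,n]≈0# n = -‿inverseʳ (n · 1#)

    difference-cong : ∀ a b c d → a ℕ.+ d ≡ c ℕ.+ b → difference (a , b) ≈ difference (c , d)
    difference-cong a b c d a+d≡c+b = begin
      difference (a , b)                           ≈⟨ +-identityʳ _ ⟨
      difference (a , b) + 0#                      ≈⟨ +-congˡ (difference[n,n]≈0# d) ⟨
      difference (a , b) + difference (d , d)      ≈⟨ difference-+ a b d d ⟨
      difference (a ℕ.+ d , b ℕ.+ d)               ≡⟨ ≡.cong₂ (λ x y → difference (x , y)) a+d≡c+b (NP.+-comm b d) ⟩
      difference (c ℕ.+ b , d ℕ.+ b)               ≈⟨ difference-+ c d b b ⟩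
      difference (c , d) + difference (b , b)      ≈⟨ +-congˡ (difference[n,n]≈0# b) ⟩
      difference (c , d) + 0#                      ≈⟨ +-identityʳ _ ⟩
      difference (c , d)                           ∎

    ⟦reduce⟧≈difference : ∀ x → ⟦ reduce x ⟧ ≈ difference x
    ⟦reduce⟧≈difference x = trans (⟦⟧≈difference (reduce x)) (difference∘reduce x)

    homomorphism : Differences -Raw-AlmostCommutative⟶ fromCommutativeRing R
    homomorphism = record
      { ⟦_⟧    = ⟦_⟧
      ; +-homo = λ (a , b) (c , d) → trans (⟦reduce⟧≈difference (a ℕ.+ c , b ℕ.+ d))
          (trans (difference-+ a b c d) (sym (+-cong (⟦⟧≈difference (a , b)) (⟦⟧≈difference (c , d)))))
      ; *-homo = λ (a , b) (c , d) → trans (⟦reduce⟧≈difference (a ℕ.* c ℕ.+ b ℕ.* d , a ℕ.* d ℕ.+ b ℕ.* c))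
          (trans (difference-* a b c d) (sym (*-cong (⟦⟧≈difference (a , b)) (⟦⟧≈difference (c , d)))))
      ; -‿homo = λ (a , b) → trans (⟦⟧≈difference (b , a))
          (trans (difference-swap a b) (sym (-‿cong (⟦⟧≈difference (a , b)))))
      ; 0-homo = refl
      ; 1-homo = refl
      }

    _≟⟦⟧_ : WeaklyDecidable (λ x y → ⟦ x ⟧ ≈ ⟦ y ⟧)
    (a , b) ≟⟦⟧ (c , d) with a ℕ.+ d ℕ.≟ c ℕ.+ b
    ... | no _        = nothing
    ... | yes a+d≡c+b = just (begin
      ⟦ a , b ⟧            ≈⟨ ⟦⟧≈difference (a , b) ⟩
      difference (a , b)   ≈⟨ difference-cong a b c d a+d≡c+b ⟩
      difference (c , d)   ≈⟨ ⟦⟧≈difference (c , d) ⟨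
      ⟦ c , d ⟧            ∎)

  open import Algebra.Solver.Ring Differences (fromCommutativeRing R) homomorphism _≟⟦⟧_ public
    using (solve; _:=_; _:+_; _:*_; _:-_; :-_; con)

[1+k]*[1+n]C[1+k]≡[1+n]*nCk : ∀ n k → suc k ℕ.* (suc n C suc k) ≡ suc n ℕ.* (n C k)
[1+k]*[1+n]C[1+k]≡[1+n]*nCk zero    zero    = ≡.refl
[1+k]*[1+n]C[1+k]≡[1+n]*nCk zero    (suc k) = NP.*-zeroʳ (suc (suc k))
[1+k]*[1+n]C[1+k]≡[1+n]*nCk (suc n) zero    = begin
  1 ℕ.* (suc (suc n) C 1)  ≡⟨ NP.*-identityˡ _ ⟩
  suc (suc n) C 1          ≡⟨ nC1≡n (suc (suc n)) ⟩
  suc (suc n)              ≡⟨ NP.*-identityʳ _ ⟨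
  suc (suc n) ℕ.* 1        ∎
  where open ≡.≡-Reasoning
[1+k]*[1+n]C[1+k]≡[1+n]*nCk (suc n) (suc k) = begin
  suc k′ ℕ.* (suc n′ C suc k′)                               ≡⟨ ≡.cong (suc k′ ℕ.*_) (nCk+nC[k+1]≡[n+1]C[k+1] n′ k′) ⟨
  suc k′ ℕ.* (n′ C k′ ℕ.+ n′ C suc k′)                       ≡⟨ NP.*-distribˡ-+ (suc k′) (n′ C k′) _ ⟩
  (n′ C k′ ℕ.+ k′ ℕ.* (n′ C k′)) ℕ.+ suc k′ ℕ.* (n′ C suc k′) ≡⟨ ≡.cong₂ (λ a b → (n′ C k′ ℕ.+ a) ℕ.+ b) ([1+k]*[1+n]C[1+k]≡[1+n]*nCk n k) ([1+k]*[1+n]C[1+k]≡[1+n]*nCk n (suc k)) ⟩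
  (n′ C k′ ℕ.+ n′ ℕ.* (n C k)) ℕ.+ n′ ℕ.* (n C suc k)         ≡⟨ NP.+-assoc (n′ C k′) _ _ ⟩
  n′ C k′ ℕ.+ (n′ ℕ.* (n C k) ℕ.+ n′ ℕ.* (n C suc k))         ≡⟨ ≡.cong (n′ C k′ ℕ.+_) (NP.*-distribˡ-+ n′ (n C k) _) ⟨
  n′ C k′ ℕ.+ n′ ℕ.* (n C k ℕ.+ n C suc k)                   ≡⟨ ≡.cong (λ a → n′ C k′ ℕ.+ n′ ℕ.* a) (nCk+nC[k+1]≡[n+1]C[k+1] n k) ⟩
  suc n′ ℕ.* (n′ C k′)                                       ∎
  where
  open ≡.≡-Reasoning
  n′ = suc n
  k′ = suc k

p∣pCk : ∀ {p k} → Prime p → 0 < k → k < p → p ∣ p C k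
p∣pCk {suc n} {suc k} p-prime _ k<p
  with euclidsLemma (suc k) (suc n C suc k) p-prime
         (divides (n C k) (≡.trans ([1+k]*[1+n]C[1+k]≡[1+n]*nCk n k) (NP.*-comm (suc n) (n C k))))
... | inj₁ p∣1+k   = contradiction (∣⇒≤ p∣1+k) (NP.<⇒≱ k<p)
... | inj₂ p∣pC1+k = p∣pC1+k

module AdditivePowers {c ℓ} (R : CommutativeRing c ℓ) where
  open CommutativeRing R
  open import Algebra.Properties.Ring ring using (+-inverseʳ-unique)
  open import Algebra.Properties.Semiring.Exp semiring using (^-assocʳ; ^-congˡ) renaming (_^_ to _^ᵣ_)
  open import Algebra.Properties.Semiring.Mult semiring
    using (×-congʳ; ×-assoc-*; ×1-homo-*) renaming (_×_ to _·_)
  open import Algebra.Properties.Semiring.Sum semiring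
    using (sum; sum-init-last; sum-cong-≋; sum-replicate-zero)
  open import Algebra.Properties.CommutativeSemiring.Binomial commutativeSemiring
    using (theorem; binomialTerm)
  open import Relation.Binary.Reasoning.Setoid setoid

  AdditivePower : ℕ → Set (c ⊔ ℓ)
  AdditivePower n = ∀ x y → (x + y) ^ᵣ n ≈ x ^ᵣ n + y ^ᵣ n

  additivePower-^ : ∀ {n} → AdditivePower n → ∀ j → AdditivePower (n ℕ.^ j)
  additivePower-^ additive zero    x y = trans (*-identityʳ _) (sym (+-cong (*-identityʳ x) (*-identityʳ y)))
  additivePower-^ {n} additive (suc j) x y = begin
    (x + y) ^ᵣ (n ℕ.* N)          ≈⟨ ^-assocʳ (x + y) n N ⟨
    ((x + y) ^ᵣ n) ^ᵣ N            ≈⟨ ^-congˡ N (additive x y) ⟩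
    (x ^ᵣ n + y ^ᵣ n) ^ᵣ N          ≈⟨ additivePower-^ additive j (x ^ᵣ n) (y ^ᵣ n) ⟩
    (x ^ᵣ n) ^ᵣ N + (y ^ᵣ n) ^ᵣ N    ≈⟨ +-cong (^-assocʳ x n N) (^-assocʳ y n N) ⟩
    x ^ᵣ (n ℕ.* N) + y ^ᵣ (n ℕ.* N) ∎
    where N = n ℕ.^ j

  additivePower-‿ : ∀ {n} .{{_ : NonZero n}} → AdditivePower n → ∀ x → (- x) ^ᵣ n ≈ - (x ^ᵣ n)
  additivePower-‿ {suc n} additive x = +-inverseʳ-unique (x ^ᵣ suc n) ((- x) ^ᵣ suc n) (begin
    x ^ᵣ suc n + (- x) ^ᵣ suc n  ≈⟨ additive x (- x) ⟨
    (x - x) ^ᵣ suc n            ≈⟨ ^-congˡ (suc n) (-‿inverseʳ x) ⟩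
    0# * 0# ^ᵣ n                ≈⟨ zeroˡ _ ⟩
    0#                         ∎)

  frobenius : ∀ {p} → Prime p → p · 1# ≈ 0# → AdditivePower p
  frobenius {zero}  p-prime = contradiction p-prime ¬prime[0]
  frobenius {suc n} p-prime char x y = begin
    (x + y) ^ᵣ p                                   ≈⟨ theorem p x y ⟩
    term Fin.zero + sum (λ k → term (Fin.suc k))  ≈⟨ +-congˡ (sum-init-last (λ k → term (Fin.suc k))) ⟩
    term Fin.zero + (sum (λ k → term (Fin.suc (inject₁ k))) + term (fromℕ p))
                                                  ≈⟨ +-congˡ (+-congʳ (trans (sum-cong-≋ interior≈0) (sum-replicate-zero n))) ⟩
    term Fin.zero + (0# + term (fromℕ p))          ≈⟨ +-cong first≈y^p (trans (+-identityˡ _) last≈x^p) ⟩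
    y ^ᵣ p + x ^ᵣ p                                 ≈⟨ +-comm _ _ ⟩
    x ^ᵣ p + y ^ᵣ p                                 ∎
    where
    p = suc n
    term = binomialTerm x y p
    multiple≈0 : ∀ r z → (r ℕ.* p) · z ≈ 0#
    multiple≈0 r z = begin
      (r ℕ.* p) · z                ≈⟨ ×-congʳ (r ℕ.* p) (*-identityˡ z) ⟨
      (r ℕ.* p) · (1# * z)         ≈⟨ ×-assoc-* (r ℕ.* p) 1# z ⟨
      ((r ℕ.* p) · 1#) * z         ≈⟨ *-congʳ (×1-homo-* r p) ⟩
      ((r · 1#) * (p · 1#)) * z    ≈⟨ *-congʳ (*-congˡ char) ⟩
      ((r · 1#) * 0#) * z          ≈⟨ *-congʳ (zeroʳ _) ⟩
      0# * z                       ≈⟨ zeroˡ z ⟩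
      0#                           ∎
    interior≈0 : ∀ k → term (Fin.suc (inject₁ k)) ≈ 0#
    interior≈0 k with p∣pCk p-prime (s≤s z≤n) (s≤s (≡.subst (_< n) (≡.sym (FinP.toℕ-inject₁ k)) (FinP.toℕ<n k)))
    ... | divides r pCi≡r*p = trans (reflexive (≡.cong (_· (x ^ᵣ i * y ^ᵣ (p ℕ.∸ i))) pCi≡r*p)) (multiple≈0 r _)
      where i = suc (toℕ (inject₁ k))
    first≈y^p : term Fin.zero ≈ y ^ᵣ p
    first≈y^p = trans (+-identityʳ _) (*-identityˡ _)
    last≈x^p : term (fromℕ p) ≈ x ^ᵣ p
    last≈x^p = begin
      term (fromℕ p)                          ≡⟨ ≡.cong (λ k → (p C k) · (x ^ᵣ k * y ^ᵣ (p ℕ.∸ k))) (FinP.toℕ-fromℕ p) ⟩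
      (p C p) · (x ^ᵣ p * y ^ᵣ (p ℕ.∸ p))       ≡⟨ ≡.cong₂ (λ a b → a · (x ^ᵣ p * y ^ᵣ b)) (nCn≡1 p) (NP.n∸n≡0 p) ⟩
      1 · (x ^ᵣ p * 1#)                        ≈⟨ trans (+-identityʳ _) (*-identityʳ _) ⟩
      x ^ᵣ p                                   ∎

module FieldProperties {c ℓ} (F : Field c ℓ) where
  open Field F
  open FieldOps F
  open import Algebra.Properties.Semiring.Exp semiring using (^-congˡ; ^-homo-*; ^-assocʳ) renaming (_^_ to _^ᵣ_)
  open import Algebra.Properties.CommutativeSemiring.Exp commutativeSemiring using (^-distrib-*)
  open import Algebra.Properties.Semiring.Mult semiring using () renaming (_×_ to _·_)
  open import Relation.Binary.Reasoning.Setoid setoid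

  pow≡^ : ∀ x n → pow x n ≡ x ^ᵣ n
  pow≡^ x zero    = ≡.refl
  pow≡^ x (suc n) = ≡.cong (x *_) (pow≡^ x n)

  natCast≡·1# : ∀ n → natCast n ≡ n · 1#
  natCast≡·1# zero    = ≡.refl
  natCast≡·1# (suc n) = ≡.cong (1# +_) (natCast≡·1# n)

  pow-congˡ : ∀ n {x y} → x ≈ y → pow x n ≈ pow y n
  pow-congˡ n {x} {y} x≈y rewrite pow≡^ x n | pow≡^ y n = ^-congˡ n x≈y

  pow-homo-* : ∀ x m n → pow x (m ℕ.+ n) ≈ pow x m * pow x n
  pow-homo-* x m n rewrite pow≡^ x (m ℕ.+ n) | pow≡^ x m | pow≡^ x n = ^-homo-* x m n

  pow-assocʳ : ∀ x m n → pow (pow x m) n ≈ pow x (m ℕ.* n)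
  pow-assocʳ x m n rewrite pow≡^ (pow x m) n | pow≡^ x m | pow≡^ x (m ℕ.* n) = ^-assocʳ x m n

  pow-distrib-* : ∀ x y n → pow (x * y) n ≈ pow x n * pow y n
  pow-distrib-* x y n rewrite pow≡^ (x * y) n | pow≡^ x n | pow≡^ y n = ^-distrib-* x y n

  pow-zeroˡ : ∀ n .{{_ : NonZero n}} → pow 0# n ≈ 0#
  pow-zeroˡ (suc n) = zeroˡ _

  1#≉0# : 1# ≉ 0#
  1#≉0# 1≈0 = 0≉1 (sym 1≈0)

  ⁻¹-inverseˡ : ∀ x → x ≉ 0# → x ⁻¹ * x ≈ 1#
  ⁻¹-inverseˡ x x≉0 = trans (*-comm _ _) (⁻¹-inverse x x≉0)

  *-cancelˡ : ∀ {x y z} → x ≉ 0# → x * y ≈ x * z → y ≈ z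
  *-cancelˡ {x} {y} {z} x≉0 xy≈xz = begin
    y                ≈⟨ *-identityˡ y ⟨
    1# * y           ≈⟨ *-congʳ (⁻¹-inverseˡ x x≉0) ⟨
    (x ⁻¹ * x) * y   ≈⟨ *-assoc _ _ _ ⟩
    x ⁻¹ * (x * y)   ≈⟨ *-congˡ xy≈xz ⟩
    x ⁻¹ * (x * z)   ≈⟨ *-assoc _ _ _ ⟨
    (x ⁻¹ * x) * z   ≈⟨ *-congʳ (⁻¹-inverseˡ x x≉0) ⟩
    1# * z           ≈⟨ *-identityˡ z ⟩
    z                ∎

  x≉0∧y≉0⇒x*y≉0 : ∀ {x y} → x ≉ 0# → y ≉ 0# → x * y ≉ 0#
  x≉0∧y≉0⇒x*y≉0 {x} {y} x≉0 y≉0 xy≈0 = y≉0 (*-cancelˡ x≉0 (trans xy≈0 (sym (zeroʳ x))))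

  pow≉0 : ∀ {x} n → x ≉ 0# → pow x n ≉ 0#
  pow≉0 zero    x≉0 = 1#≉0#
  pow≉0 (suc n) x≉0 = x≉0∧y≉0⇒x*y≉0 x≉0 (pow≉0 n x≉0)

  ⁻¹-unique : ∀ {x y} → x ≉ 0# → x * y ≈ 1# → y ≈ x ⁻¹
  ⁻¹-unique {x} x≉0 xy≈1 = *-cancelˡ x≉0 (trans xy≈1 (sym (⁻¹-inverse x x≉0)))

  1⁻¹≈1 : 1# ⁻¹ ≈ 1#
  1⁻¹≈1 = sym (⁻¹-unique 1#≉0# (*-identityˡ 1#))

  ⁻¹-distrib-* : ∀ {x y} → x ≉ 0# → y ≉ 0# → (x * y) ⁻¹ ≈ x ⁻¹ * y ⁻¹
  ⁻¹-distrib-* {x} {y} x≉0 y≉0 = sym (⁻¹-unique (x≉0∧y≉0⇒x*y≉0 x≉0 y≉0) (begin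
    (x * y) * (x ⁻¹ * y ⁻¹)    ≈⟨ *-assoc _ _ _ ⟩
    x * (y * (x ⁻¹ * y ⁻¹))    ≈⟨ *-congˡ (x∙yz≈y∙xz y (x ⁻¹) (y ⁻¹)) ⟩
    x * (x ⁻¹ * (y * y ⁻¹))    ≈⟨ *-assoc _ _ _ ⟨
    (x * x ⁻¹) * (y * y ⁻¹)    ≈⟨ *-cong (⁻¹-inverse x x≉0) (⁻¹-inverse y y≉0) ⟩
    1# * 1#                    ≈⟨ *-identityˡ 1# ⟩
    1#                         ∎))
    where open import Algebra.Properties.CommutativeSemigroup *-commutativeSemigroup using (x∙yz≈y∙xz)

  [1*x]⁻¹≈x⁻¹ : ∀ {x} → x ≉ 0# → (1# * x) ⁻¹ ≈ x ⁻¹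
  [1*x]⁻¹≈x⁻¹ x≉0 = trans (⁻¹-distrib-* 1#≉0# x≉0) (trans (*-congʳ 1⁻¹≈1) (*-identityˡ _))

  sumTo≈last : ∀ (f : ℕ → Carrier) n → (∀ i → i ℕ.< n → f i ≈ 0#) → sumTo n f ≈ f n
  sumTo≈last f zero    _        = refl
  sumTo≈last f (suc n) below≈0 = begin
    sumTo n f + f (suc n)  ≈⟨ +-congʳ (sumTo≈last f n (λ i i<n → below≈0 i (NP.m<n⇒m<1+n i<n))) ⟩
    f n + f (suc n)        ≈⟨ +-congʳ (below≈0 n NP.≤-refl) ⟩
    0# + f (suc n)         ≈⟨ +-identityˡ _ ⟩
    f (suc n)              ∎

  sumList-++ : ∀ {A : Set} (f : A → Carrier) xs ys →
               sumList (map f (xs ++ ys)) ≈ sumList (map f xs) + sumList (map f ys)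
  sumList-++ f []       ys = sym (+-identityˡ _)
  sumList-++ f (x ∷ xs) ys = trans (+-congˡ (sumList-++ f xs ys)) (sym (+-assoc _ _ _))

  sumList-map-*ˡ : ∀ {A B : Set} (f : A → Carrier) (g : B → A) (h : B → Carrier) k →
                   (∀ x → f (g x) ≈ k * h x) → ∀ xs → sumList (map f (map g xs)) ≈ k * sumList (map h xs)
  sumList-map-*ˡ f g h k f∘g≈k*h []       = sym (zeroʳ k)
  sumList-map-*ˡ f g h k f∘g≈k*h (x ∷ xs) =
    trans (+-cong (f∘g≈k*h x) (sumList-map-*ˡ f g h k f∘g≈k*h xs)) (sym (distribˡ k _ _))

module LinearRecurrence {c ℓ} (F : Field c ℓ) (a : Field.Carrier F) (b d : ℕ → Field.Carrier F) where
  open Field F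
  open FieldProperties F using (*-cancelˡ)
  open import Relation.Binary.Reasoning.Setoid setoid

  record IsSolution (x y : ℕ → Carrier) : Set ℓ where
    field
      partialSum : ∀ n → x (suc n) ≈ x n + y (suc n)
      step       : ∀ n → b n * y (suc n) ≈ a * x n + d n * y n

  open IsSolution

  solution-unique : ∀ {x y x′ y′} → (∀ n → b n ≉ 0#) →
                    IsSolution x y → IsSolution x′ y′ → x 0 ≈ x′ 0 → y 0 ≈ y′ 0 →
                    ∀ n → x n ≈ x′ n × y n ≈ y′ n
  solution-unique b≉0 sol sol′ x₀ y₀ zero = x₀ , y₀
  solution-unique {x} {y} {x′} {y′} b≉0 sol sol′ x₀ y₀ (suc n) = xₙ₊₁ , yₙ₊₁
    where
    IH = solution-unique b≉0 sol sol′ x₀ y₀ n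
    yₙ₊₁ : y (suc n) ≈ y′ (suc n)
    yₙ₊₁ = *-cancelˡ (b≉0 n) (begin
      b n * y (suc n)         ≈⟨ step sol n ⟩
      a * x n + d n * y n     ≈⟨ +-cong (*-congˡ (proj₁ IH)) (*-congˡ (proj₂ IH)) ⟩
      a * x′ n + d n * y′ n   ≈⟨ step sol′ n ⟨
      b n * y′ (suc n)        ∎)
    xₙ₊₁ : x (suc n) ≈ x′ (suc n)
    xₙ₊₁ = begin
      x (suc n)          ≈⟨ partialSum sol n ⟩
      x n + y (suc n)    ≈⟨ +-cong (proj₁ IH) yₙ₊₁ ⟩
      x′ n + y′ (suc n)  ≈⟨ partialSum sol′ n ⟨
      x′ (suc n)         ∎

module DrinfeldModule {c ℓ} (F : Field c ℓ) (q : ℕ) .{{_ : NonZero q}} (T Δ : Field.Carrier F) where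
  open Field F
  open FieldOps F
  open FieldProperties F
  open DifferenceCoefficientRingSolver commutativeRing
  open AdditivePowers commutativeRing using (AdditivePower; additivePower-^; additivePower-‿)
  open import Algebra.Properties.Ring ring using (x∙y⁻¹≈ε⇒x≈y)
  open import Relation.Binary.Reasoning.Setoid setoid

  t d : ℕ → Carrier
  t k = pow T (q ^ k)
  d k = pow Δ (q ^ k)

  open LinearRecurrence F T (λ n → bracket q T (suc n)) d public

  T^q^k≉T⇒T≉0 : (∀ k → 1 ≤ k → ¬ (pow T (q ^ k) ≈ T)) → T ≉ 0#
  T^q^k≉T⇒T≉0 T^q^k≉T T≈0 = T^q^k≉T 1 (s≤s z≤n) (begin
    pow T (q ^ 1)   ≈⟨ pow-congˡ (q ^ 1) T≈0 ⟩
    pow 0# (q ^ 1)  ≈⟨ pow-zeroˡ (q ^ 1) {{NP.m^n≢0 q 1}} ⟩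
    0#              ≈⟨ T≈0 ⟨
    T               ∎)

  T^q^k≉T⇒bracket≉0 : (∀ k → 1 ≤ k → ¬ (pow T (q ^ k) ≈ T)) → ∀ n → bracket q T (suc n) ≉ 0#
  T^q^k≉T⇒bracket≉0 T^q^k≉T n bracket≈0 = T^q^k≉T (suc n) (s≤s z≤n) (x∙y⁻¹≈ε⇒x≈y _ _ bracket≈0)

  phiT-vanishes : ∀ {i k} → i < k → phiT T Δ (2 ℕ.+ k ∸ i) ≡ 0#
  phiT-vanishes {zero}  {suc k} _         = ≡.refl
  phiT-vanishes {suc i} {suc k} (s≤s i<k) = phiT-vanishes i<k

  twistedCoeff-phiT : ∀ (β : ℕ → Carrier) k →
    twistedCoeff q β (phiT T Δ) (2 ℕ.+ k)
      ≈ (β k * d k + β (1 ℕ.+ k) * pow (- (T + Δ)) (q ^ (1 ℕ.+ k))) + β (2 ℕ.+ k) * t (2 ℕ.+ k)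
  twistedCoeff-phiT β k = +-cong (+-cong lowest (reflexive middle)) (reflexive highest)
    where
    term : ℕ → Carrier
    term i = β i * pow (phiT T Δ (2 ℕ.+ k ∸ i)) (q ^ i)
    lowest : sumTo k term ≈ β k * d k
    lowest = begin
      sumTo k term  ≈⟨ sumTo≈last term k (λ i i<k → begin
                          term i                   ≡⟨ ≡.cong (λ φ → β i * pow φ (q ^ i)) (phiT-vanishes i<k) ⟩
                          β i * pow 0# (q ^ i)     ≈⟨ *-congˡ (pow-zeroˡ (q ^ i) {{NP.m^n≢0 q i}}) ⟩
                          β i * 0#                 ≈⟨ zeroʳ _ ⟩
                          0#                       ∎) ⟩
      term k        ≡⟨ ≡.cong (λ j → β k * pow (phiT T Δ j) (q ^ k)) (NP.m+n∸n≡m 2 k) ⟩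
      β k * d k     ∎
    middle : term (1 ℕ.+ k) ≡ β (1 ℕ.+ k) * pow (- (T + Δ)) (q ^ (1 ℕ.+ k))
    middle = ≡.cong (λ j → β (1 ℕ.+ k) * pow (phiT T Δ j) (q ^ (1 ℕ.+ k))) (NP.m+n∸n≡m 1 k)
    highest : term (2 ℕ.+ k) ≡ β (2 ℕ.+ k) * t (2 ℕ.+ k)
    highest = ≡.cong (λ j → β (2 ℕ.+ k) * pow (phiT T Δ j) (q ^ (2 ℕ.+ k))) (NP.n∸n≡0 (2 ℕ.+ k))

  module Logarithm (q-additive : AdditivePower q) (β : ℕ → Carrier) (isLog : IsLogarithm q T Δ β) where

    -[T+Δ]^q^j : ∀ j → pow (- (T + Δ)) (q ^ j) ≈ - (t j + d j)
    -[T+Δ]^q^j j rewrite pow≡^ (- (T + Δ)) (q ^ j) | pow≡^ T (q ^ j) | pow≡^ Δ (q ^ j) =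
      trans (additivePower-‿ {{NP.m^n≢0 q j}} (additivePower-^ q-additive j) (T + Δ))
            (-‿cong (additivePower-^ q-additive j T Δ))

    logCoeff-1 : bracket q T 1 * β 1 ≈ β 0 * (t 0 + d 0)
    logCoeff-1 = begin
      (t 1 - T) * β 1                              ≈⟨ solve 3 (λ t₁ T β₁ → (t₁ :- T) :* β₁ := β₁ :* t₁ :- T :* β₁) refl (t 1) T (β 1) ⟩
      β 1 * t 1 - T * β 1                          ≈⟨ +-congˡ (-‿cong (proj₂ isLog 1)) ⟩
      β 1 * t 1 - (β 0 * pow (- (T + Δ)) (q ^ 0) + β 1 * t 1)
                                                   ≈⟨ +-congˡ (-‿cong (+-congʳ (*-congˡ (-[T+Δ]^q^j 0)))) ⟩
      β 1 * t 1 - (β 0 * - (t 0 + d 0) + β 1 * t 1)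
        ≈⟨ solve 4 (λ β₀ β₁ t₁ s → β₁ :* t₁ :- (β₀ :* (:- s) :+ β₁ :* t₁) := β₀ :* s) refl (β 0) (β 1) (t 1) (t 0 + d 0) ⟩
      β 0 * (t 0 + d 0)                            ∎

    logCoeff-2+ : ∀ k → bracket q T (2 ℕ.+ k) * β (2 ℕ.+ k) ≈ β (1 ℕ.+ k) * (t (1 ℕ.+ k) + d (1 ℕ.+ k)) - β k * d k
    logCoeff-2+ k = begin
      (t₂ - T) * β₂                                       ≈⟨ solve 3 (λ t₂ T β₂ → (t₂ :- T) :* β₂ := β₂ :* t₂ :- T :* β₂) refl t₂ T β₂ ⟩
      β₂ * t₂ - T * β₂                                    ≈⟨ +-congˡ (-‿cong (trans (proj₂ isLog (2 ℕ.+ k)) (twistedCoeff-phiT β k))) ⟩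
      β₂ * t₂ - ((β₀ * d₀ + β₁ * pow (- (T + Δ)) (q ^ (1 ℕ.+ k))) + β₂ * t₂)
                                                          ≈⟨ +-congˡ (-‿cong (+-congʳ (+-congˡ (*-congˡ (-[T+Δ]^q^j (1 ℕ.+ k)))))) ⟩
      β₂ * t₂ - ((β₀ * d₀ + β₁ * - s₁) + β₂ * t₂)
        ≈⟨ solve 6 (λ β₀ β₁ β₂ d₀ t₂ s₁ → β₂ :* t₂ :- ((β₀ :* d₀ :+ β₁ :* (:- s₁)) :+ β₂ :* t₂) := β₁ :* s₁ :- β₀ :* d₀)
                 refl β₀ β₁ β₂ d₀ t₂ s₁ ⟩
      β₁ * s₁ - β₀ * d₀                                   ∎
      where
      β₀ = β k; β₁ = β (1 ℕ.+ k); β₂ = β (2 ℕ.+ k)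
      d₀ = d k; t₂ = t (2 ℕ.+ k); s₁ = t (1 ℕ.+ k) + d (1 ℕ.+ k)

    logSum logTerm : ℕ → Carrier
    logSum n  = T * sumTo n β
    logTerm n = T * β n

    logTerm-suc : ∀ n → bracket q T (suc n) * logTerm (suc n) ≈ T * logSum n + d n * logTerm n
    logTerm-suc zero = begin
      (t 1 - T) * (T * β 1)       ≈⟨ solve 3 (λ x T y → x :* (T :* y) := T :* (x :* y)) refl (t 1 - T) T (β 1) ⟩
      T * ((t 1 - T) * β 1)       ≈⟨ *-congˡ logCoeff-1 ⟩
      T * (β 0 * (t 0 + d 0))     ≈⟨ *-congˡ (*-congˡ (+-congʳ (*-identityʳ T))) ⟩
      T * (β 0 * (T + d 0))       ≈⟨ solve 3 (λ T β₀ d₀ → T :* (β₀ :* (T :+ d₀)) := T :* (T :* β₀) :+ d₀ :* (T :* β₀)) refl T (β 0) (d 0) ⟩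
      T * logSum 0 + d 0 * logTerm 0 ∎
    logTerm-suc (suc n) = begin
      (t₂ - T) * (T * β₂)                          ≈⟨ solve 3 (λ x T y → x :* (T :* y) := T :* (x :* y)) refl (t₂ - T) T β₂ ⟩
      T * ((t₂ - T) * β₂)                          ≈⟨ *-congˡ (logCoeff-2+ n) ⟩
      T * (β₁ * (t₁ + d₁) - β₀ * d₀)
        ≈⟨ solve 6 (λ T β₀ β₁ d₀ d₁ t₁ → T :* (β₁ :* (t₁ :+ d₁) :- β₀ :* d₀)
                      := (((t₁ :- T) :* (T :* β₁) :+ T :* (T :* β₁)) :+ d₁ :* (T :* β₁)) :- d₀ :* (T :* β₀))
                 refl T β₀ β₁ d₀ d₁ t₁ ⟩
      (((t₁ - T) * (T * β₁) + T * (T * β₁)) + d₁ * (T * β₁)) - d₀ * (T * β₀)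
                                                   ≈⟨ +-congʳ (+-congʳ (+-congʳ (logTerm-suc n))) ⟩
      (((T * (T * S) + d₀ * (T * β₀)) + T * (T * β₁)) + d₁ * (T * β₁)) - d₀ * (T * β₀)
        ≈⟨ solve 6 (λ T β₀ β₁ d₀ d₁ S → (((T :* (T :* S) :+ d₀ :* (T :* β₀)) :+ T :* (T :* β₁)) :+ d₁ :* (T :* β₁)) :- d₀ :* (T :* β₀)
                      := T :* (T :* (S :+ β₁)) :+ d₁ :* (T :* β₁))
                 refl T β₀ β₁ d₀ d₁ S ⟩
      T * logSum (suc n) + d (suc n) * logTerm (suc n) ∎
      where
      β₀ = β n; β₁ = β (suc n); β₂ = β (2 ℕ.+ n)
      d₀ = d n; d₁ = d (suc n); t₁ = t (suc n); t₂ = t (2 ℕ.+ n)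
      S = sumTo n β

    logTerm-0 : logTerm 0 ≈ T
    logTerm-0 = trans (*-congˡ (proj₁ isLog)) (*-identityʳ T)

    logarithm-solution : IsSolution logSum logTerm
    logarithm-solution = record { partialSum = λ n → distribˡ T (sumTo n β) (β (suc n)) ; step = logTerm-suc }

  module SubsetSums (T≉0 : T ≉ 0#) where

    D : Carrier
    D = Δ / pow T q

    E J : ℕ → Carrier
    E k = pow D (q ^ k)
    J k = pow T (q ^ k ∸ 1) ⁻¹

    -- subsetSum i prev n sums over S ⊆ {i, …, i+n−1}; prev records whether i−1 ∈ S, which decides
    -- whether i ∈ S starts a run (i ∈ M(S)). The theorem's sum is subsetSum 0 false n.
    weight : ℕ → Bool → ∀ {n} → Vec Bool n → Carrier
    weight i prev S = pow D (wFrom q i S) / mFrom q T i prev S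

    subsetSum : ℕ → Bool → ℕ → Carrier
    subsetSum i prev n = sumList (map (weight i prev) (subsets n))

    mFrom≉0 : ∀ i prev {n} (S : Vec Bool n) → mFrom q T i prev S ≉ 0#
    mFrom≉0 i prev []      = 1#≉0#
    mFrom≉0 i prev (b ∷ S) = x≉0∧y≉0⇒x*y≉0 (factor≉0 (b ∧ not prev)) (mFrom≉0 (suc i) b S)
      where
      factor≉0 : ∀ new → (if new then pow T (q ^ i ∸ 1) else 1#) ≉ 0#
      factor≉0 true  = pow≉0 (q ^ i ∸ 1) T≉0
      factor≉0 false = 1#≉0#

    K : ℕ → Bool → Carrier
    K i true  = E i
    K i false = E i * J i

    weight-true : ∀ i prev {n} (S : Vec Bool n) → weight i prev (true ∷ S) ≈ K i prev * weight (suc i) true S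
    weight-true i true S = begin
      pow D (q ^ i ℕ.+ w′) * (1# * M) ⁻¹   ≈⟨ *-cong (pow-homo-* D (q ^ i) w′) ([1*x]⁻¹≈x⁻¹ (mFrom≉0 (suc i) true S)) ⟩
      (E i * pow D w′) * M ⁻¹              ≈⟨ *-assoc _ _ _ ⟩
      E i * (pow D w′ * M ⁻¹)              ∎
      where w′ = wFrom q (suc i) S; M = mFrom q T (suc i) true S
    weight-true i false S = begin
      pow D (q ^ i ℕ.+ w′) * (Y * M) ⁻¹    ≈⟨ *-cong (pow-homo-* D (q ^ i) w′) (⁻¹-distrib-* (pow≉0 (q ^ i ∸ 1) T≉0) (mFrom≉0 (suc i) true S)) ⟩
      (E i * pow D w′) * (J i * M ⁻¹)      ≈⟨ solve 4 (λ e p j m → (e :* p) :* (j :* m) := (e :* j) :* (p :* m)) refl (E i) (pow D w′) (J i) (M ⁻¹) ⟩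
      (E i * J i) * (pow D w′ * M ⁻¹)      ∎
      where w′ = wFrom q (suc i) S; M = mFrom q T (suc i) true S; Y = pow T (q ^ i ∸ 1)

    weight-false : ∀ i prev {n} (S : Vec Bool n) → weight i prev (false ∷ S) ≈ weight (suc i) false S
    weight-false i prev S = *-congˡ ([1*x]⁻¹≈x⁻¹ (mFrom≉0 (suc i) false S))

    subsetSum-suc : ∀ i prev n → subsetSum i prev (suc n) ≈ K i prev * subsetSum (suc i) true n + subsetSum (suc i) false n
    subsetSum-suc i prev n = begin
      sumList (map (weight i prev) (map (true ∷_) (subsets n) ++ map (false ∷_) (subsets n)))
        ≈⟨ sumList-++ (weight i prev) (map (true ∷_) (subsets n)) (map (false ∷_) (subsets n)) ⟩
      sumList (map (weight i prev) (map (true ∷_) (subsets n))) + sumList (map (weight i prev) (map (false ∷_) (subsets n)))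
        ≈⟨ +-cong (sumList-map-*ˡ (weight i prev) (true ∷_) (weight (suc i) true) (K i prev) (weight-true i prev) (subsets n))
                  (trans (sumList-map-*ˡ (weight i prev) (false ∷_) (weight (suc i) false) 1#
                                         (λ S → trans (weight-false i prev S) (sym (*-identityˡ _))) (subsets n))
                         (*-identityˡ _)) ⟩
      K i prev * subsetSum (suc i) true n + subsetSum (suc i) false n ∎

    open Setoid (×-setoid setoid setoid) using ()
      renaming (Carrier to State; _≈_ to _≋_; refl to ≋-refl; trans to ≋-trans)

    -- A state (a , b) splits a subset sum by whether the last element is in S;
    -- step k adds the element k, which gains D^{q^k}, and T^{1−q^k} when k−1 ∉ S.
    step : ℕ → State → State
    step k (a , b) = E k * (a + b * J k) , a + b

    run : ℕ → ℕ → State → State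
    run i zero    u = u
    run i (suc n) u = run (suc i) n (step i u)

    initial : Bool → State
    initial true  = 1# , 0#
    initial false = 0# , 1#

    total : State → Carrier
    total (a , b) = a + b

    lincomb : Carrier → State → State → State
    lincomb k (a , b) (a′ , b′) = k * a + a′ , k * b + b′

    step-cong : ∀ k {u v} → u ≋ v → step k u ≋ step k v
    step-cong k (a≈ , b≈) = *-congˡ (+-cong a≈ (*-congʳ b≈)) , +-cong a≈ b≈

    step-lincomb : ∀ i k u v → step i (lincomb k u v) ≋ lincomb k (step i u) (step i v)
    step-lincomb i k (a , b) (a′ , b′) =
      solve 7 (λ e j k a b a′ b′ → e :* ((k :* a :+ a′) :+ (k :* b :+ b′) :* j) := k :* (e :* (a :+ b :* j)) :+ e :* (a′ :+ b′ :* j))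
            refl (E i) (J i) k a b a′ b′ ,
      solve 5 (λ k a b a′ b′ → (k :* a :+ a′) :+ (k :* b :+ b′) := k :* (a :+ b) :+ (a′ :+ b′)) refl k a b a′ b′

    run-cong : ∀ i n {u v} → u ≋ v → run i n u ≋ run i n v
    run-cong i zero    u≋v = u≋v
    run-cong i (suc n) u≋v = run-cong (suc i) n (step-cong i u≋v)

    run-lincomb : ∀ i n k u v → run i n (lincomb k u v) ≋ lincomb k (run i n u) (run i n v)
    run-lincomb i zero    k u v = ≋-refl
    run-lincomb i (suc n) k u v =
      ≋-trans (run-cong (suc i) n (step-lincomb i k u v)) (run-lincomb (suc i) n k (step i u) (step i v))

    run-suc : ∀ i n u → run i (suc n) u ≡ step (i ℕ.+ n) (run i n u)
    run-suc i zero    u = ≡.cong (λ k → step k u) (≡.sym (NP.+-identityʳ i))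
    run-suc i (suc n) u = ≡.trans (run-suc (suc i) n (step i u)) (≡.cong (λ k → step k (run i (suc n) u)) (≡.sym (NP.+-suc i n)))

    step-initial : ∀ i prev → step i (initial prev) ≋ lincomb (K i prev) (initial true) (initial false)
    step-initial i true  =
      solve 2 (λ e j → e :* (con (1 , 0) :+ con (0 , 0) :* j) := e :* con (1 , 0) :+ con (0 , 0)) refl (E i) (J i) ,
      solve 1 (λ e → con (1 , 0) :+ con (0 , 0) := e :* con (0 , 0) :+ con (1 , 0)) refl (E i)
    step-initial i false =
      solve 2 (λ e j → e :* (con (0 , 0) :+ con (1 , 0) :* j) := (e :* j) :* con (1 , 0) :+ con (0 , 0)) refl (E i) (J i) ,
      solve 1 (λ k → con (0 , 0) :+ con (1 , 0) := k :* con (0 , 0) :+ con (1 , 0)) refl (E i * J i)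

    total-cong : ∀ {u v} → u ≋ v → total u ≈ total v
    total-cong (a≈ , b≈) = +-cong a≈ b≈

    total-lincomb : ∀ k u v → total (lincomb k u v) ≈ k * total u + total v
    total-lincomb k (a , b) (a′ , b′) =
      solve 5 (λ k a b a′ b′ → (k :* a :+ a′) :+ (k :* b :+ b′) := k :* (a :+ b) :+ (a′ :+ b′)) refl k a b a′ b′

    -- subsets enumerates by the first element while run appends the last one; linearity of run
    -- reconciles the two.
    subsetSum≈total∘run : ∀ n i prev → subsetSum i prev n ≈ total (run i n (initial prev))
    subsetSum≈total∘run zero i prev = trans (+-congʳ (trans (*-identityˡ _) 1⁻¹≈1)) (initial-total prev)
      where
      initial-total : ∀ prev → 1# + 0# ≈ total (initial prev)
      initial-total true  = refl
      initial-total false = +-comm 1# 0#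
    subsetSum≈total∘run (suc n) i prev = begin
      subsetSum i prev (suc n)                                 ≈⟨ subsetSum-suc i prev n ⟩
      K i prev * subsetSum (suc i) true n + subsetSum (suc i) false n
        ≈⟨ +-cong (*-congˡ (subsetSum≈total∘run n (suc i) true)) (subsetSum≈total∘run n (suc i) false) ⟩
      K i prev * total (run (suc i) n (initial true)) + total (run (suc i) n (initial false))
        ≈⟨ total-lincomb (K i prev) _ _ ⟨
      total (lincomb (K i prev) (run (suc i) n (initial true)) (run (suc i) n (initial false)))
        ≈⟨ total-cong (run-lincomb (suc i) n (K i prev) (initial true) (initial false)) ⟨
      total (run (suc i) n (lincomb (K i prev) (initial true) (initial false)))
        ≈⟨ total-cong (run-cong (suc i) n (step-initial i prev)) ⟨
      total (run i (suc n) (initial prev))                       ∎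

  module ClosedForm (T≉0 : T ≉ 0#) (bracket≉0 : ∀ n → bracket q T (suc n) ≉ 0#) where
    open SubsetSums T≉0 public

    A B : ℕ → Carrier
    A n = proj₁ (run 0 n (initial false))
    B n = proj₂ (run 0 n (initial false))

    A-suc : ∀ n → A (suc n) ≡ E n * (A n + B n * J n)
    A-suc n = ≡.cong proj₁ (run-suc 0 n (initial false))

    B-suc : ∀ n → B (suc n) ≡ A n + B n
    B-suc n = ≡.cong proj₂ (run-suc 0 n (initial false))

    prefactor : ℕ → Carrier
    prefactor n = pow T (ℕ-sum n (q ^_)) / L q T n

    closedSum closedTerm : ℕ → Carrier
    closedSum n  = prefactor n * (A n + B n)
    closedTerm n = prefactor n * (A n + B n * J n)

    L≉0 : ∀ n → L q T n ≉ 0#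
    L≉0 zero    = 1#≉0#
    L≉0 (suc n) = x≉0∧y≉0⇒x*y≉0 (bracket≉0 n) (L≉0 n)

    prefactor-suc : ∀ n → prefactor (suc n) * bracket q T (suc n) ≈ prefactor n * t (suc n)
    prefactor-suc n = begin
      pow T (ℕ-sum n (q ^_) ℕ.+ q ^ suc n) * (b * L q T n) ⁻¹ * b
        ≈⟨ *-congʳ (*-cong (pow-homo-* T (ℕ-sum n (q ^_)) (q ^ suc n)) (⁻¹-distrib-* (bracket≉0 n) (L≉0 n))) ⟩
      (pow T (ℕ-sum n (q ^_)) * t (suc n)) * (b ⁻¹ * L q T n ⁻¹) * b
        ≈⟨ solve 5 (λ p t b b⁻¹ l⁻¹ → (p :* t) :* (b⁻¹ :* l⁻¹) :* b := (p :* l⁻¹) :* t :* (b :* b⁻¹))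
                 refl (pow T (ℕ-sum n (q ^_))) (t (suc n)) b (b ⁻¹) (L q T n ⁻¹) ⟩
      prefactor n * t (suc n) * (b * b ⁻¹)  ≈⟨ *-congˡ (⁻¹-inverse b (bracket≉0 n)) ⟩
      prefactor n * t (suc n) * 1#          ≈⟨ *-identityʳ _ ⟩
      prefactor n * t (suc n)               ∎
      where b = bracket q T (suc n)

    E*t≈d : ∀ n → E n * t (suc n) ≈ d n
    E*t≈d n = begin
      pow (Δ * u ⁻¹) Q * pow T (q ℕ.* Q)   ≈⟨ *-congˡ (pow-assocʳ T q Q) ⟨
      pow (Δ * u ⁻¹) Q * pow u Q           ≈⟨ pow-distrib-* (Δ * u ⁻¹) u Q ⟨
      pow ((Δ * u ⁻¹) * u) Q               ≈⟨ pow-congˡ Q (trans (*-assoc _ _ _) (trans (*-congˡ (⁻¹-inverseˡ u (pow≉0 q T≉0))) (*-identityʳ Δ))) ⟩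
      pow Δ Q                              ∎
      where u = pow T q; Q = q ^ n

    J*t≈T : ∀ n → J n * t n ≈ T
    J*t≈T n = begin
      pow T k ⁻¹ * pow T (q ^ n)         ≡⟨ ≡.cong (λ j → pow T k ⁻¹ * pow T j) (NP.m+[n∸m]≡n (NP.m^n>0 q n)) ⟨
      pow T k ⁻¹ * (T * pow T k)         ≈⟨ x∙yz≈y∙xz _ _ _ ⟩
      T * (pow T k ⁻¹ * pow T k)         ≈⟨ *-congˡ (⁻¹-inverseˡ (pow T k) (pow≉0 k T≉0)) ⟩
      T * 1#                             ≈⟨ *-identityʳ T ⟩
      T                                  ∎
      where
      k = q ^ n ∸ 1
      open import Algebra.Properties.CommutativeSemigroup *-commutativeSemigroup using (x∙yz≈y∙xz)

    prefactor≈ : ∀ n → prefactor n ≈ prefactor (suc n) * (1# - J (suc n))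
    prefactor≈ n = *-cancelˡ (pow≉0 (q ^ suc n) T≉0) (begin
      t′ * prefactor n                      ≈⟨ *-comm _ _ ⟩
      prefactor n * t′                      ≈⟨ prefactor-suc n ⟨
      prefactor (suc n) * (t′ - T)          ≈⟨ *-congˡ (+-congˡ (-‿cong (J*t≈T (suc n)))) ⟨
      prefactor (suc n) * (t′ - J (suc n) * t′)
        ≈⟨ solve 3 (λ p t j → p :* (t :- j :* t) := t :* (p :* (con (1 , 0) :- j))) refl (prefactor (suc n)) t′ (J (suc n)) ⟩
      t′ * (prefactor (suc n) * (1# - J (suc n))) ∎)
      where t′ = t (suc n)

    closedSum-suc : ∀ n → closedSum (suc n) ≈ closedSum n + closedTerm (suc n)
    closedSum-suc n = begin
      p′ * (A′ + B′)                              ≈⟨ solve 4 (λ p a b j → p :* (a :+ b) := (p :* (con (1 , 0) :- j)) :* b :+ p :* (a :+ b :* j)) refl p′ A′ B′ J′ ⟩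
      (p′ * (1# - J′)) * B′ + p′ * (A′ + B′ * J′) ≈⟨ +-congʳ (*-cong (prefactor≈ n) (reflexive (≡.sym (B-suc n)))) ⟨
      prefactor n * (A n + B n) + closedTerm (suc n) ∎
      where p′ = prefactor (suc n); A′ = A (suc n); B′ = B (suc n); J′ = J (suc n)
    closedTerm-suc : ∀ n → bracket q T (suc n) * closedTerm (suc n) ≈ T * closedSum n + d n * closedTerm n
    closedTerm-suc n = begin
      b * (p′ * (A (suc n) + B (suc n) * J′))               ≈⟨ solve 3 (λ b p x → b :* (p :* x) := (p :* b) :* x) refl b p′ _ ⟩
      (p′ * b) * (A (suc n) + B (suc n) * J′)               ≈⟨ *-cong (prefactor-suc n) (+-cong (reflexive (A-suc n)) (*-congʳ (reflexive (B-suc n)))) ⟩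
      (p * t′) * (E n * (A n + B n * J n) + (A n + B n) * J′)
        ≈⟨ solve 7 (λ p t e a b j j′ → (p :* t) :* (e :* (a :+ b :* j) :+ (a :+ b) :* j′)
                      := (j′ :* t) :* (p :* (a :+ b)) :+ (e :* t) :* (p :* (a :+ b :* j)))
                 refl p t′ (E n) (A n) (B n) (J n) J′ ⟩
      (J′ * t′) * closedSum n + (E n * t′) * closedTerm n   ≈⟨ +-cong (*-congʳ (J*t≈T (suc n))) (*-congʳ (E*t≈d n)) ⟩
      T * closedSum n + d n * closedTerm n                   ∎
      where b = bracket q T (suc n); p = prefactor n; p′ = prefactor (suc n); t′ = t (suc n); J′ = J (suc n)

    closedForm-solution : IsSolution closedSum closedTerm
    closedForm-solution = record { partialSum = closedSum-suc ; step = closedTerm-suc }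

    closedSum-0 : closedSum 0 ≈ T
    closedSum-0 = begin
      ((T * 1#) * 1# ⁻¹) * (0# + 1#)  ≈⟨ *-congʳ (*-congˡ 1⁻¹≈1) ⟩
      ((T * 1#) * 1#) * (0# + 1#)     ≈⟨ solve 1 (λ T → ((T :* con (1 , 0)) :* con (1 , 0)) :* (con (0 , 0) :+ con (1 , 0)) := T) refl T ⟩
      T                               ∎

    closedTerm-0 : closedTerm 0 ≈ T
    closedTerm-0 = begin
      ((T * 1#) * 1# ⁻¹) * (0# + 1# * 1# ⁻¹)  ≈⟨ *-cong (*-congˡ 1⁻¹≈1) (+-congˡ (*-congˡ 1⁻¹≈1)) ⟩
      ((T * 1#) * 1#) * (0# + 1# * 1#)       ≈⟨ solve 1 (λ T → ((T :* con (1 , 0)) :* con (1 , 0)) :* (con (0 , 0) :+ con (1 , 0) :* con (1 , 0)) := T) refl T ⟩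
      T                                      ∎

mainTheorem2 : ∀ {c ℓ : Level} (F : Field c ℓ) →
    let open Field F
        open FieldOps F
    in (p e q : ℕ) → Prime p → 1 ≤ e → q ≡ p ^ e →
       natCast p ≈ 0# →
       (T Δ : Carrier) →
       (∀ k → 1 ≤ k → ¬ (pow T (q ^ k) ≈ T)) →
       ¬ (Δ ≈ 0#) →
       (β : ℕ → Carrier) → IsLogarithm q T Δ β →
       ∀ n →
         T * sumTo n β
           ≈ (pow T (ℕ-sum n (λ i → q ^ i)) / L q T n)
             * sumList (map (λ (S : Vec Bool n) → pow (Δ / pow T q) (w q S) / m q T S) (subsets n))
mainTheorem2 F p e q p-prime _ ≡.refl char T Δ T^q^k≉T _ β isLog n = begin
  T * sumTo n β                      ≈⟨ proj₁ (solution-unique bracket≉0 logarithm-solution closedForm-solution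
                                                 (trans logTerm-0 (sym closedSum-0)) (trans logTerm-0 (sym closedTerm-0)) n) ⟩
  closedSum n                        ≈⟨ *-congˡ (subsetSum≈total∘run n 0 false) ⟨
  prefactor n * subsetSum 0 false n  ∎
  where
  open Field F
  open FieldOps F
  open FieldProperties F using (natCast≡·1#)
  open AdditivePowers commutativeRing using (AdditivePower; additivePower-^; frobenius)
  open import Relation.Binary.Reasoning.Setoid setoid
  instance
    q≢0 : NonZero q
    q≢0 = NP.m^n≢0 p e {{prime⇒nonZero p-prime}}
  q-additive : AdditivePower q
  q-additive = additivePower-^ (frobenius p-prime (≡.subst (_≈ 0#) (natCast≡·1# p) char)) e
  open DrinfeldModule F q T Δ
  bracket≉0 : ∀ k → bracket q T (suc k) ≉ 0#
  bracket≉0 = T^q^k≉T⇒bracket≉0 T^q^k≉T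
  open Logarithm q-additive β isLog
  open ClosedForm (T^q^k≉T⇒T≉0 T^q^k≉T) bracket≉0
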